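{- Let $\mathbb{C}$ be one of $\mathbb{C}_{\mathrm{rn}},\mathbb{C}_{\mathrm{vs}},\mathbb{C}_{\mathrm{ts}}$, let $T$ be a coherent theory and $\Vdash$ the forcing relation relative to the coverage $\lhd_T$. For every sentence $\phi$ (not necessarily coherent), if $T\vdash_\emptyset\phi$ then $(;)\Vdash\phi$.
   Context: Signature $\Sigma$ single-sorted; formulas possibly infinitary and possibly with equality. Conditions $(X;A)$: $X$ finite set of variables, $A$ finite set of atoms over $X$ (no equations); $(;)$ is the empty condition; $\mathrm{Tm}(X)$ the terms over $X$. $\mathbb{C}_{\mathrm{ts}}$: morphisms $f:(Y;B)\to(X;A)$ are maps $f:X\to\mathrm{Tm}(Y)$ with $Af\subseteq B$; $\mathbb{C}_{\mathrm{vs}}$: variable-to-variable maps; $\mathbb{C}_{\mathrm{rn}}$: injective variable maps. Coherent theory $T$ (without equality): axioms $\forall\vec x.(\phi_0\to\exists\vec x_1.\phi_1\lor\dots\lor\exists\vec x_k.\phi_k)$, $\phi_i$ finite conjunctions of atoms. $\lhd_T$ is inductively generated by: isomorphism singletons cover; if an instance (terms over $X$ for the universal variables) $\phi_0\to\exists\vec x_1.\phi_1\lor\dots\lor\exists\vec x_n.\phi_n$ of an axiom has atoms of $\phi_0$ in $A$, $\vec x_i$ fresh, and $(X,\vec x_i;A,\phi_i)\lhd_T U_i$, then $(X;A)\lhd_T\bigcup_ie_iU_i$, $e_i$ the identity-on-$X$ morphism $(X,\vec x_i;A,\phi_i)\to(X;A)$. Forcing: $\top$ always; $\bot$ iff $C\lhd_T\emptyset$;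 atom $\psi$ iff some $U\rhd C$ with $\psi f$ an atom of the domain for all $f\in U$; $s=t$ iff some $U\rhd C$ with $sf=tf$ for all $f\in U$; $\bigwedge$ componentwise; $\bigvee_i\psi_i$ iff some $U\rhd C$ with each $f:D\to C$ in $U$ having $D\Vdash\psi_if$ for some $i$; $\psi_1\to\psi_2$ iff for all $f:D\to C$, $D\Vdash\psi_1f\Rightarrow D\Vdash\psi_2f$; $\forall x.\psi$ iff $D\Vdash\psi[f,x:=t]$ for all $f:D\to C$, $t\in\mathrm{Tm}(D)$; $\exists x.\psi$ iff some $U\rhd C$ with each $f:D\to C$ in $U$ having some $t\in\mathrm{Tm}(D)$ with $D\Vdash\psi[f,x:=t]$. $T\vdash_\emptyset\phi$: derivability from $T$ in intuitionistic natural deduction with equality, possibly infinitary, with empty variable context and quantifier rules valid for possibly empty domains (existential introduction and universal elimination only with terms over the current variable context). -}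

module Defs where

open import Data.Nat using (ℕ; zero; suc; _+_)
open import Data.Fin using (Fin; zero; suc; splitAt; _↑ˡ_; _↑ʳ_)
open import Data.Fin.Properties using (↑ʳ-injective)
open import Data.Vec using (Vec; []; _∷_)
open import Data.List using (List; []; _∷_; map; _++_; length; lookup)
open import Data.List.Membership.Propositional using (_∈_)
open import Data.List.Membership.Propositional.Properties using (∈-map⁺; ∈-++⁺ˡ)
open import Data.Product using (Σ; _×_; _,_; proj₁; proj₂)
open import Data.Sum using (_⊎_; inj₁; inj₂; [_,_])
open import Data.Unit using (⊤; tt)
open import Data.Empty using (⊥)
open import Level using (Lift)
open import Function.Definitions using (Injective)
open import Relation.Binary.PropositionalEquality using (_≡_; refl; sym; trans; cong; cong₂; subst)

record Signature : Set₁ where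
  field
    FunSym : Set
    funAr  : FunSym → ℕ
    RelSym : Set
    relAr  : RelSym → ℕ

data Cat : Set where
  Crn Cvs Cts : Cat

module _ (S : Signature) where
  open Signature S

-- Syntax over a signature.  Variables of a context of size n are Fin n
-- (de Bruijn style); a "finite set of variables X" is a context Fin n.

  data Tm (n : ℕ) : Set where
    var : Fin n → Tm n
    app : (f : FunSym) → Vec (Tm n) (funAr f) → Tm n

  -- atoms (relational only, no equations)
  data Atom (n : ℕ) : Set where
    rel : (R : RelSym) → Vec (Tm n) (relAr R) → Atom n

  -- possibly infinitary first-order formulas with equality;
  -- ∀' / ∃' bind the variable  zero  of the extended context
  data Fm (n : ℕ) : Set₁ where
    ⊤' ⊥' : Fm n
    atom  : Atom n → Fm n
    _≐_   : Tm n → Tm n → Fm n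
    ⋀ ⋁   : (I : Set) → (I → Fm n) → Fm n
    _⇒_   : Fm n → Fm n → Fm n
    ∀' ∃' : Fm (suc n) → Fm n

  Sentence : Set₁
  Sentence = Fm 0

  Sub : ℕ → ℕ → Set
  Sub m n = Fin m → Tm n

  mutual
    substTm : ∀ {m n} → Sub m n → Tm m → Tm n
    substTm σ (var x)    = σ x
    substTm σ (app f ts) = app f (substVec σ ts)

    substVec : ∀ {m n k} → Sub m n → Vec (Tm m) k → Vec (Tm n) k
    substVec σ []       = []
    substVec σ (t ∷ ts) = substTm σ t ∷ substVec σ ts

  substAtom : ∀ {m n} → Sub m n → Atom m → Atom n
  substAtom σ (rel R ts) = rel R (substVec σ ts)

  -- sequential composition: first σ, then τ
  _⨾_ : ∀ {m n k} → Sub m n → Sub n k → Sub m k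
  (σ ⨾ τ) x = substTm τ (σ x)

  -- [σ, x := t]  (the new variable is zero)
  _▸_ : ∀ {m n} → Sub m n → Tm n → Sub (suc m) n
  (σ ▸ t) zero    = t
  (σ ▸ t) (suc x) = σ x

  wkSub : ∀ {n} → Sub n (suc n)
  wkSub x = var (suc x)

  lift : ∀ {m n} → Sub m n → Sub (suc m) (suc n)
  lift σ zero    = var zero
  lift σ (suc x) = substTm wkSub (σ x)

  substFm : ∀ {m n} → Sub m n → Fm m → Fm n
  substFm σ ⊤'        = ⊤'
  substFm σ ⊥'        = ⊥'
  substFm σ (atom a)  = atom (substAtom σ a)
  substFm σ (s ≐ t)   = substTm σ s ≐ substTm σ t
  substFm σ (⋀ I φ)   = ⋀ I (λ i → substFm σ (φ i))
  substFm σ (⋁ I φ)   = ⋁ I (λ i → substFm σ (φ i))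
  substFm σ (φ ⇒ ψ)   = substFm σ φ ⇒ substFm σ ψ
  substFm σ (∀' φ)    = ∀' (substFm (lift σ) φ)
  substFm σ (∃' φ)    = ∃' (substFm (lift σ) φ)

  wkFm : ∀ {n} → Fm n → Fm (suc n)
  wkFm = substFm wkSub

  inst : ∀ {n} → Fm (suc n) → Tm n → Fm n
  inst φ t = substFm (var ▸ t) φ

  mutual
    substTm-⨾ : ∀ {m n k} (σ : Sub m n) (τ : Sub n k) (t : Tm m) →
                substTm τ (substTm σ t) ≡ substTm (σ ⨾ τ) t
    substTm-⨾ σ τ (var x)    = refl
    substTm-⨾ σ τ (app f ts) = cong (app f) (substVec-⨾ σ τ ts)

    substVec-⨾ : ∀ {m n k j} (σ : Sub m n) (τ : Sub n k) (ts : Vec (Tm m) j) →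
                 substVec τ (substVec σ ts) ≡ substVec (σ ⨾ τ) ts
    substVec-⨾ σ τ []       = refl
    substVec-⨾ σ τ (t ∷ ts) = cong₂ _∷_ (substTm-⨾ σ τ t) (substVec-⨾ σ τ ts)

  substAtom-⨾ : ∀ {m n k} (σ : Sub m n) (τ : Sub n k) (a : Atom m) →
                substAtom τ (substAtom σ a) ≡ substAtom (σ ⨾ τ) a
  substAtom-⨾ σ τ (rel R ts) = cong (rel R) (substVec-⨾ σ τ ts)

  conj : ∀ {n} → List (Atom n) → Fm n
  conj A = ⋀ (Fin (length A)) (λ i → atom (lookup A i))

  allN : ∀ m → Fm m → Fm 0
  allN zero    φ = φ
  allN (suc m) φ = allN m (∀' φ)

  exN : ∀ k {m} → Fm (k + m) → Fm m
  exN zero    φ = φ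
  exN (suc k) φ = exN k (∃' φ)

-- Coherent theories (without equality)
--   ∀x⃗. (φ₀ → ∃x⃗₁.φ₁ ∨ … ∨ ∃x⃗_d.φ_d)
-- with m universal variables; disjunct i has k i existential variables,
-- which are the variables  j ↑ˡ m  of  Fin (k i + m); the universal
-- variables are  k i ↑ʳ x.

  record CoherentAxiom : Set where
    field
      m     : ℕ
      prem  : List (Atom m)
      d     : ℕ
      k     : Fin d → ℕ
      concl : (i : Fin d) → List (Atom (k i + m))

  record CoherentTheory : Set₁ where
    field
      Ax    : Set
      axiom : Ax → CoherentAxiom

  axiomSentence : CoherentAxiom → Sentence
  axiomSentence a = allN m (conj prem ⇒ ⋁ (Fin d) (λ i → exN (k i) (conj (concl i))))
    where open CoherentAxiom a

-- Natural deduction (intuitionistic, infinitary, with equality, with an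
-- explicit variable context n, valid for possibly empty domains:
-- ∀E and ∃I only with terms over the current context).

  module _ (T : CoherentTheory) where
    open CoherentTheory T

    data Der (n : ℕ) (Γ : List (Fm n)) : Fm n → Set₁ where
      hyp   : ∀ {φ} → φ ∈ Γ → Der n Γ φ
      axT   : (a : Ax) → Der n Γ (substFm (λ ()) (axiomSentence (axiom a)))
      ⊤I    : Der n Γ ⊤'
      ⊥E    : ∀ {φ} → Der n Γ ⊥' → Der n Γ φ
      ⋀I    : ∀ {I φ} → ((i : I) → Der n Γ (φ i)) → Der n Γ (⋀ I φ)
      ⋀E    : ∀ {I φ} → Der n Γ (⋀ I φ) → (i : I) → Der n Γ (φ i)
      ⋁I    : ∀ {I φ} → (i : I) → Der n Γ (φ i) → Der n Γ (⋁ I φ)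
      ⋁E    : ∀ {I φ ψ} → Der n Γ (⋁ I φ) → ((i : I) → Der n (φ i ∷ Γ) ψ) → Der n Γ ψ
      ⇒I    : ∀ {φ ψ} → Der n (φ ∷ Γ) ψ → Der n Γ (φ ⇒ ψ)
      ⇒E    : ∀ {φ ψ} → Der n Γ (φ ⇒ ψ) → Der n Γ φ → Der n Γ ψ
      ∀I    : ∀ {φ} → Der (suc n) (map wkFm Γ) φ → Der n Γ (∀' φ)
      ∀E    : ∀ {φ} → Der n Γ (∀' φ) → (t : Tm n) → Der n Γ (inst φ t)
      ∃I    : ∀ {φ} → (t : Tm n) → Der n Γ (inst φ t) → Der n Γ (∃' φ)
      ∃E    : ∀ {φ ψ} → Der n Γ (∃' φ) → Der (suc n) (φ ∷ map wkFm Γ) (wkFm ψ) → Der n Γ ψ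
      ≐refl : ∀ {t} → Der n Γ (t ≐ t)
      ≐E    : ∀ {s t} → Der n Γ (s ≐ t) → (φ : Fm (suc n)) →
              Der n Γ (inst φ s) → Der n Γ (inst φ t)

    _⊢∅_ : Sentence → Set₁
    _⊢∅_ φ = Der 0 [] φ

  record Cond : Set where
    constructor ⟨_∣_⟩
    field
      vars  : ℕ
      atoms : List (Atom vars)
  open Cond public

  emptyCond : Cond
  emptyCond = ⟨ 0 ∣ [] ⟩

  IsMor : Cat → ∀ {m n} → Sub m n → Set
  IsMor Cts f = ⊤
  IsMor Cvs {m} {n} f = Σ (Fin m → Fin n) λ g → ∀ x → f x ≡ var (g x)
  IsMor Crn {m} {n} f = Σ (Fin m → Fin n) λ g → Injective _≡_ _≡_ g × (∀ x → f x ≡ var (g x))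

  -- a morphism f : D → C is a map  vars C → Tm (vars D)  with  A f ⊆ B
  record Hom (c : Cat) (D C : Cond) : Set where
    field
      mor   : Sub (vars C) (vars D)
      kind  : IsMor c mor
      pres  : ∀ {a} → a ∈ atoms C → substAtom mor a ∈ atoms D
  open Hom public

  IsMor-∘ : ∀ {c m n k} (f : Sub m n) (g : Sub n k) → IsMor c f → IsMor c g → IsMor c (f ⨾ g)
  IsMor-∘ {Cts} f g _ _ = tt
  IsMor-∘ {Cvs} f g (h₁ , p₁) (h₂ , p₂) =
    (λ x → h₂ (h₁ x)) , λ x → trans (cong (substTm g) (p₁ x)) (p₂ (h₁ x))
  IsMor-∘ {Crn} f g (h₁ , i₁ , p₁) (h₂ , i₂ , p₂) =
    (λ x → h₂ (h₁ x)) , (λ eq → i₁ (i₂ eq)) , λ x → trans (cong (substTm g) (p₁ x)) (p₂ (h₁ x))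

  incl-kind : ∀ {c} k {n} → IsMor c {n} {k + n} (λ x → var (k ↑ʳ x))
  incl-kind {Cts} k = tt
  incl-kind {Cvs} k = (k ↑ʳ_) , λ _ → refl
  incl-kind {Crn} k = (k ↑ʳ_) , ↑ʳ-injective k _ _ , λ _ → refl

  module _ {c : Cat} where

    _∘ₕ_ : ∀ {E D C} → Hom c D C → Hom c E D → Hom c E C
    f ∘ₕ g = record
      { mor  = mor f ⨾ mor g
      ; kind = IsMor-∘ (mor f) (mor g) (kind f) (kind g)
      ; pres = λ {a} a∈ → subst (_∈ _) (substAtom-⨾ (mor f) (mor g) a) (pres g (pres f a∈))
      }

    IsIso : ∀ {D C} → Hom c D C → Set
    IsIso {D} {C} f = Σ (Hom c C D) λ g →
      (∀ x → substTm (mor g) (mor f x) ≡ var x) × (∀ y → substTm (mor f) (mor g y) ≡ var y)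

    record Family (C : Cond) : Set₁ where
      field
        Idx : Set
        dom : Idx → Cond
        arr : (j : Idx) → Hom c (dom j) C
    open Family public

    singleton : ∀ {D C} → Hom c D C → Family C
    singleton {D} f = record { Idx = ⊤ ; dom = λ _ → D ; arr = λ _ → f }

    -- identity-on-X inclusion  (X, x⃗;B) → (X;A)  with  x⃗ = k fresh variables
    incl : ∀ (k : ℕ) {n} → Sub n (k + n)
    incl k x = var (k ↑ʳ x)


    module _ (T : CoherentTheory) where
      open CoherentTheory T

      -- instance σ of the axiom extended by the fresh variables of disjunct i
      extSub : ∀ {m n} (k : ℕ) → Sub m n → Sub (k + m) (k + n)
      extSub {m} {n} k σ x = [ (λ j → var (j ↑ˡ n)) , (λ y → substTm (incl k) (σ y)) ] (splitAt k x)

      extCond : (C : Cond) (a : CoherentAxiom) → Sub (CoherentAxiom.m a) (vars C) →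
                Fin (CoherentAxiom.d a) → Cond
      extCond C a σ i = ⟨ k i + vars C ∣ map (substAtom (incl (k i))) (atoms C)
                                        ++ map (substAtom (extSub (k i) σ)) (concl i) ⟩
        where open CoherentAxiom a

      eᵢ : (C : Cond) (a : CoherentAxiom) (σ : Sub (CoherentAxiom.m a) (vars C))
           (i : Fin (CoherentAxiom.d a)) → Hom c (extCond C a σ i) C
      eᵢ C a σ i = record
        { mor  = incl (k i)
        ; kind = incl-kind (k i)
        ; pres = λ a∈ → ∈-++⁺ˡ (∈-map⁺ (substAtom (incl (k i))) a∈)
        }
        where open CoherentAxiom a

      unionFam : (C : Cond) (a : CoherentAxiom) (σ : Sub (CoherentAxiom.m a) (vars C)) →
                 ((i : Fin (CoherentAxiom.d a)) → Family (extCond C a σ i)) → Family C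
      unionFam C a σ U = record
        { Idx = Σ (Fin (CoherentAxiom.d a)) (λ i → Idx (U i))
        ; dom = λ { (i , j) → dom (U i) j }
        ; arr = λ { (i , j) → eᵢ C a σ i ∘ₕ arr (U i) j }
        }

      data _◁_ : (C : Cond) → Family C → Set₁ where
        iso-cover : ∀ {D C} (f : Hom c D C) → IsIso f → C ◁ singleton f
        ax-cover  : ∀ {C} (x : Ax) → let a = axiom x in
                    (σ : Sub (CoherentAxiom.m a) (vars C)) →
                    (∀ {p} → p ∈ CoherentAxiom.prem a → substAtom σ p ∈ atoms C) →
                    (U : (i : Fin (CoherentAxiom.d a)) → Family (extCond C a σ i)) →
                    ((i : Fin (CoherentAxiom.d a)) → extCond C a σ i ◁ U i) →
                    C ◁ unionFam C a σ U

      -- Forcing.  Force φ C σ  is  C ⊩ φσ  (defined by recursion on φ,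
      -- carrying the substitution σ along).

      Covered : (C : Cond) → ((D : Cond) → Hom c D C → Set₁) → Set₁
      Covered C P = Σ (Family C) λ U → (C ◁ U) × ((j : Idx U) → P (dom U j) (arr U j))

      Force : ∀ {m} → Fm m → (C : Cond) → Sub m (vars C) → Set₁
      Force ⊤'       C σ = Lift _ ⊤
      Force ⊥'       C σ = Σ (Family C) λ U → (C ◁ U) × (Idx U → ⊥)
      Force (atom ψ) C σ = Covered C λ D f → Lift _ (substAtom (σ ⨾ mor f) ψ ∈ atoms D)
      Force (s ≐ t)  C σ = Covered C λ D f → Lift _ (substTm (σ ⨾ mor f) s ≡ substTm (σ ⨾ mor f) t)
      Force (⋀ I ψ)  C σ = (i : I) → Force (ψ i) C σ
      Force (⋁ I ψ)  C σ = Covered C λ D f → Σ I λ i → Force (ψ i) D (σ ⨾ mor f)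
      Force (ψ₁ ⇒ ψ₂) C σ = (D : Cond) (f : Hom c D C) →
                            Force ψ₁ D (σ ⨾ mor f) → Force ψ₂ D (σ ⨾ mor f)
      Force (∀' ψ)   C σ = (D : Cond) (f : Hom c D C) (t : Tm (vars D)) →
                            Force ψ D ((σ ⨾ mor f) ▸ t)
      Force (∃' ψ)   C σ = Covered C λ D f → Σ (Tm (vars D)) λ t → Force ψ D ((σ ⨾ mor f) ▸ t)

      _⊩_ : (C : Cond) → Fm (vars C) → Set₁
      C ⊩ φ = Force φ C var

-- The forcing relation ⊩ is a Kripke–Joyal semantics on the category ℂ of
-- conditions (ℂ_rn, ℂ_vs or ℂ_ts) with the coverage ◁_T generated by the
-- axioms of the coherent theory T.  The corollary is the soundness theorem
-- "T ⊢ φ implies (;) ⊩ φ", proved by induction on derivations for arbitrary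
-- contexts, conditions and substitutions.
module Submission where

open import Data.Nat using (ℕ; zero; suc; _+_)
open import Data.Fin using (Fin; zero; suc; splitAt; join; _↑ʳ_)
open import Data.Fin.Properties using (splitAt-↑ˡ; splitAt-↑ʳ; splitAt-join; join-splitAt)
open import Data.Vec using (Vec; []; _∷_)
open import Data.List using (List; []; _∷_; map)
open import Data.List.Membership.Propositional using (_∈_)
open import Data.List.Membership.Propositional.Properties
  using (∈-map⁺; ∈-map⁻; ∈-++⁺ˡ; ∈-++⁺ʳ; ∈-++⁻; ∈-lookup)
open import Data.List.Relation.Unary.Any using (here; there; index)
open import Data.List.Relation.Unary.Any.Properties using (lookup-index)
open import Data.Product using (Σ; _×_; _,_; proj₁; proj₂)
open import Data.Sum using (inj₁; inj₂; map₂)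
open import Data.Sum.Properties using (inj₂-injective)
open import Data.Unit using (tt)
open import Data.Empty using (⊥; ⊥-elim)
open import Function.Definitions using (Injective)
open import Level using (Lift; lift; lower)
import Level
open import Relation.Binary.Bundles using (Setoid)
open import Relation.Binary.PropositionalEquality
  using (_≡_; _≗_; refl; sym; trans; cong; cong₂; subst; module ≡-Reasoning)
import Relation.Binary.Reasoning.Setoid as SetoidReasoning

open import Defs using (Signature; Cat; Crn; Cvs; Cts; CoherentTheory; Sentence; _⊢∅_; _⊩_; emptyCond)
open import Defs using (var; app; rel; ⊤'; ⊥'; atom; _≐_; ⋀; ⋁; _⇒_; ∀'; ∃')
open import Defs using (vars; atoms; mor; kind; pres; Idx; dom; arr; iso-cover; ax-cover)
open import Defs using (hyp; axT; ⊤I; ⊥E; ⋀I; ⋀E; ⋁I; ⋁E; ⇒I; ⇒E; ∀I; ∀E; ∃I; ∃E; ≐refl; ≐E)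
import Defs as D

module Soundness (S : Signature) (c : Cat) (T : CoherentTheory S) where
  open CoherentTheory T using (Ax; axiom)

  Tm : ℕ → Set
  Tm = D.Tm S
  Atom : ℕ → Set
  Atom = D.Atom S
  Fm : ℕ → Set₁
  Fm = D.Fm S
  Sub : ℕ → ℕ → Set
  Sub = D.Sub S
  substTm : ∀ {m n} → Sub m n → Tm m → Tm n
  substTm = D.substTm S
  substVec : ∀ {m n k} → Sub m n → Vec (Tm m) k → Vec (Tm n) k
  substVec = D.substVec S
  substAtom : ∀ {m n} → Sub m n → Atom m → Atom n
  substAtom = D.substAtom S
  substFm : ∀ {m n} → Sub m n → Fm m → Fm n
  substFm = D.substFm S
  _⨾_ : ∀ {m n k} → Sub m n → Sub n k → Sub m k
  _⨾_ = D._⨾_ S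
  _▸_ : ∀ {m n} → Sub m n → Tm n → Sub (suc m) n
  _▸_ = D._▸_ S
  Cond : Set
  Cond = D.Cond S
  Hom : Cond → Cond → Set
  Hom = D.Hom S c
  _∘ₕ_ : ∀ {E D C} → Hom D C → Hom E D → Hom E C
  _∘ₕ_ = D._∘ₕ_ S
  Family : Cond → Set₁
  Family = D.Family S {c}
  _◁_ : (C : Cond) → Family C → Set₁
  _◁_ = D._◁_ S {c} T
  Covered : (C : Cond) → ((D : Cond) → Hom D C → Set₁) → Set₁
  Covered = D.Covered S {c} T
  Force : ∀ {m} → Fm m → (C : Cond) → Sub m (vars C) → Set₁
  Force = D.Force S {c} T
  CoherentAxiom : Set
  CoherentAxiom = D.CoherentAxiom S
  module CoherentAxiom = D.CoherentAxiom {S}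
  incl : (k : ℕ) {n : ℕ} → Sub n (k + n)
  incl = D.incl S {c}
  extSub : ∀ {m n} (k : ℕ) → Sub m n → Sub (k + m) (k + n)
  extSub = D.extSub S {c} T
  extCond : (C : Cond) (a : CoherentAxiom) → Sub (CoherentAxiom.m a) (vars C) →
            Fin (CoherentAxiom.d a) → Cond
  extCond = D.extCond S {c} T

  Lift₁ : Set → Set₁
  Lift₁ = Lift (Level.suc Level.zero)

  ≗-sym : ∀ {m n} {σ τ : Sub m n} → σ ≗ τ → τ ≗ σ
  ≗-sym e x = sym (e x)

  Sub-setoid : ℕ → ℕ → Setoid Level.zero Level.zero
  Sub-setoid m n = record
    { Carrier       = Sub m n
    ; _≈_           = _≗_
    ; isEquivalence = record { refl = λ _ → refl ; sym = ≗-sym ; trans = λ e e′ x → trans (e x) (e′ x) }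
    }

  module ≗-Reasoning {m n : ℕ} = SetoidReasoning (Sub-setoid m n)

  mutual
    substTm-cong : ∀ {m n} {σ τ : Sub m n} → σ ≗ τ → (t : Tm m) → substTm σ t ≡ substTm τ t
    substTm-cong e (var x)    = e x
    substTm-cong e (app f ts) = cong (app f) (substVec-cong e ts)

    substVec-cong : ∀ {m n k} {σ τ : Sub m n} → σ ≗ τ → (ts : Vec (Tm m) k) → substVec σ ts ≡ substVec τ ts
    substVec-cong e []       = refl
    substVec-cong e (t ∷ ts) = cong₂ _∷_ (substTm-cong e t) (substVec-cong e ts)

  mutual
    substTm-id : ∀ {n} (t : Tm n) → substTm var t ≡ t
    substTm-id (var x)    = refl
    substTm-id (app f ts) = cong (app f) (substVec-id ts)

    substVec-id : ∀ {n k} (ts : Vec (Tm n) k) → substVec var ts ≡ ts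
    substVec-id []       = refl
    substVec-id (t ∷ ts) = cong₂ _∷_ (substTm-id t) (substVec-id ts)

  substAtom-cong : ∀ {m n} {σ τ : Sub m n} → σ ≗ τ → (a : Atom m) → substAtom σ a ≡ substAtom τ a
  substAtom-cong e (rel R ts) = cong (rel R) (substVec-cong e ts)

  substAtom-id : ∀ {n} (a : Atom n) → substAtom var a ≡ a
  substAtom-id (rel R ts) = cong (rel R) (substVec-id ts)

  substTm-comp : ∀ {m n k} (σ : Sub m n) {τ : Sub n k} {ρ : Sub m k} → (σ ⨾ τ) ≗ ρ →
                 (t : Tm m) → substTm τ (substTm σ t) ≡ substTm ρ t
  substTm-comp σ {τ} e t = trans (D.substTm-⨾ S σ τ t) (substTm-cong e t)

  substAtom-comp : ∀ {m n k} (σ : Sub m n) {τ : Sub n k} {ρ : Sub m k} → (σ ⨾ τ) ≗ ρ →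
                   (a : Atom m) → substAtom τ (substAtom σ a) ≡ substAtom ρ a
  substAtom-comp σ {τ} e a = trans (D.substAtom-⨾ S σ τ a) (substAtom-cong e a)

  ⨾-assoc : ∀ {m n k j} (σ : Sub m n) (τ : Sub n k) (ρ : Sub k j) → ((σ ⨾ τ) ⨾ ρ) ≗ (σ ⨾ (τ ⨾ ρ))
  ⨾-assoc σ τ ρ x = D.substTm-⨾ S τ ρ (σ x)

  ⨾-congˡ : ∀ {m n k} {σ σ′ : Sub m n} (τ : Sub n k) → σ ≗ σ′ → (σ ⨾ τ) ≗ (σ′ ⨾ τ)
  ⨾-congˡ τ e x = cong (substTm τ) (e x)

  ⨾-congʳ : ∀ {m n k} (σ : Sub m n) {τ τ′ : Sub n k} → τ ≗ τ′ → (σ ⨾ τ) ≗ (σ ⨾ τ′)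
  ⨾-congʳ σ e x = substTm-cong e (σ x)

  ⨾-identityʳ : ∀ {m n} (σ : Sub m n) → (σ ⨾ var) ≗ σ
  ⨾-identityʳ σ x = substTm-id (σ x)

  ⨾-restrict : ∀ {m n k j} (τ : Sub m n) {σ : Sub n k} {ρ : Sub m k} (θ : Sub k j) →
               (τ ⨾ σ) ≗ ρ → (τ ⨾ (σ ⨾ θ)) ≗ (ρ ⨾ θ)
  ⨾-restrict τ {σ} θ e x = trans (sym (D.substTm-⨾ S σ θ (τ x))) (cong (substTm θ) (e x))

  ▸-cong : ∀ {m n} {σ σ′ : Sub m n} {t t′ : Tm n} → σ ≗ σ′ → t ≡ t′ → (σ ▸ t) ≗ (σ′ ▸ t′)
  ▸-cong e t≡t′ zero    = t≡t′
  ▸-cong e t≡t′ (suc x) = e x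

  ▸-⨾ : ∀ {m n k} {ρ : Sub m n} {t : Tm n} {τ : Sub n k} → ((ρ ▸ t) ⨾ τ) ≗ ((ρ ⨾ τ) ▸ substTm τ t)
  ▸-⨾ zero    = refl
  ▸-⨾ (suc x) = refl

  lift-⨾-▸ : ∀ {m n k} (τ : Sub m n) {σ : Sub n k} {ρ : Sub m k} {t : Tm k} →
             (τ ⨾ σ) ≗ ρ → (D.lift S τ ⨾ (σ ▸ t)) ≗ (ρ ▸ t)
  lift-⨾-▸ τ e zero    = refl
  lift-⨾-▸ τ e (suc x) = trans (substTm-comp (D.wkSub S) (λ _ → refl) (τ x)) (e x)

  id-kind : ∀ c′ {n} → D.IsMor S c′ {n} {n} var
  id-kind Cts = tt
  id-kind Cvs = (λ x → x) , λ _ → refl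
  id-kind Crn = (λ x → x) , (λ e → e) , λ _ → refl

  idHom : ∀ {C} → Hom C C
  idHom = record
    { mor  = var
    ; kind = id-kind c
    ; pres = λ {a} a∈ → subst (_∈ _) (sym (substAtom-id a)) a∈
    }

  idHom-iso : ∀ {C} → D.IsIso S {c} (idHom {C})
  idHom-iso = idHom , (λ _ → refl) , (λ _ → refl)

  incl-⨾-extSub : ∀ {m n} (k : ℕ) (g : Sub m n) → (incl k ⨾ extSub k g) ≗ (g ⨾ incl k)
  incl-⨾-extSub {m} k g x rewrite splitAt-↑ʳ k m x = refl

  extSub-⨾ : ∀ {m n j} (k : ℕ) (σ : Sub m n) (g : Sub n j) → (extSub k σ ⨾ extSub k g) ≗ extSub k (σ ⨾ g)
  extSub-⨾ {n = n} k σ g x with splitAt k x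
  ... | inj₁ i rewrite splitAt-↑ˡ k i n = refl
  ... | inj₂ y =
    trans (substTm-comp (incl k) (incl-⨾-extSub k g) (σ y)) (sym (D.substTm-⨾ S g (incl k) (σ y)))

  extRenaming : ∀ {m n} (k : ℕ) → (Fin m → Fin n) → Fin (k + m) → Fin (k + n)
  extRenaming {n = n} k h x = join k n (map₂ h (splitAt k x))

  extSub-renaming : ∀ {m n} (k : ℕ) (g : Sub m n) (h : Fin m → Fin n) → (∀ x → g x ≡ var (h x)) →
                    ∀ x → extSub k g x ≡ var (extRenaming k h x)
  extSub-renaming k g h g≡h x with splitAt k x
  ... | inj₁ i = refl
  ... | inj₂ y rewrite g≡h y = refl

  -- the extension of an injective renaming is injective (needed for ℂ_rn)
  extRenaming-injective : ∀ {m n} (k : ℕ) {h : Fin m → Fin n} → Injective _≡_ _≡_ h →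
                          Injective _≡_ _≡_ (extRenaming k h)
  extRenaming-injective {m} {n} k {h} h-inj {x} {x′} eq = begin
    x                        ≡⟨ join-splitAt k m x ⟨
    join k m (splitAt k x)   ≡⟨ cong (join k m) (map₂-injective {splitAt k x} {splitAt k x′} split≡) ⟩
    join k m (splitAt k x′)  ≡⟨ join-splitAt k m x′ ⟩
    x′                       ∎
    where
    open ≡-Reasoning
    split≡ : map₂ h (splitAt k x) ≡ map₂ h (splitAt k x′)
    split≡ = trans (sym (splitAt-join k n _)) (trans (cong (splitAt k) eq) (splitAt-join k n _))
    map₂-injective : Injective _≡_ _≡_ (map₂ {A = Fin k} h)
    map₂-injective {inj₁ _} {inj₁ _} refl = refl
    map₂-injective {inj₂ _} {inj₂ _} e    = cong inj₂ (h-inj (inj₂-injective e))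

  extSub-kind : ∀ c′ (k : ℕ) {m n} (g : Sub m n) → D.IsMor S c′ g → D.IsMor S c′ (extSub k g)
  extSub-kind Cts k g _               = tt
  extSub-kind Cvs k g (h , g≡h)       = extRenaming k h , extSub-renaming k g h g≡h
  extSub-kind Crn k g (h , inj , g≡h) =
    extRenaming k h , extRenaming-injective k inj , extSub-renaming k g h g≡h

  extend-hom : (a : CoherentAxiom) {C E : Cond} (σ : Sub (CoherentAxiom.m a) (vars C)) (g : Hom E C)
               (i : Fin (CoherentAxiom.d a)) → Hom (extCond E a (σ ⨾ mor g) i) (extCond C a σ i)
  extend-hom a {C} {E} σ g i = record
    { mor  = extSub k (mor g)
    ; kind = extSub-kind c k (mor g) (kind g)
    ; pres = preserves
    }
    where
    k : ℕ
    k = CoherentAxiom.k a i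

    old-atom : ∀ b → substAtom (incl k) (substAtom (mor g) b) ≡
                     substAtom (extSub k (mor g)) (substAtom (incl k) b)
    old-atom b =
      trans (D.substAtom-⨾ S (mor g) (incl k) b) (sym (substAtom-comp (incl k) (incl-⨾-extSub k (mor g)) b))

    preserves : ∀ {b} → b ∈ atoms (extCond C a σ i) →
                substAtom (extSub k (mor g)) b ∈ atoms (extCond E a (σ ⨾ mor g) i)
    preserves b∈ with ∈-++⁻ (map (substAtom (incl k)) (atoms C)) b∈
    ... | inj₁ old with ∈-map⁻ (substAtom (incl k)) old
    ...   | b , b∈C , refl = subst (_∈ _) (old-atom b) (∈-++⁺ˡ (∈-map⁺ (substAtom (incl k)) (pres g b∈C)))
    preserves b∈ | inj₂ new with ∈-map⁻ (substAtom (extSub k σ)) new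
    ...   | p , p∈ , refl = subst (_∈ _) (sym (substAtom-comp (extSub k σ) (extSub-⨾ k σ (mor g)) p))
                              (∈-++⁺ʳ _ (∈-map⁺ (substAtom (extSub k (σ ⨾ mor g))) p∈))

  covered-by-identity : ∀ {C} (P : (D : Cond) → Hom D C → Set₁) → P C idHom → Covered C P
  covered-by-identity P p = D.singleton S idHom , iso-cover idHom idHom-iso , λ _ → p

  FactorsThrough : ∀ {C} (U : Family C) {D} (g : Hom D C) (E : Cond) → Hom E D → Set₁
  FactorsThrough U g E h = Lift₁ (Σ (Idx U) λ j → Σ (Hom E (dom U j)) λ h′ →
                                     (mor g ⨾ mor h) ≗ (mor (arr U j) ⨾ mor h′))

  -- An axiom cover is pulled back to the cover by
  -- the same axiom instance composed with g, using extend-hom.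
  cover-pullback : ∀ {C} {U : Family C} → C ◁ U → ∀ {D} (g : Hom D C) → Covered D (FactorsThrough U g)
  cover-pullback (iso-cover f (f⁻¹ , f⨾f⁻¹≗id , _)) g =
    covered-by-identity (FactorsThrough (D.singleton S f) g) (lift (tt , f⁻¹ ∘ₕ g , g-factors))
    where
    open ≗-Reasoning
    g-factors : (mor g ⨾ var) ≗ (mor f ⨾ (mor f⁻¹ ⨾ mor g))
    g-factors = begin
      mor g ⨾ var                ≈⟨ ⨾-identityʳ (mor g) ⟩
      var ⨾ mor g                ≈⟨ ⨾-congˡ (mor g) f⨾f⁻¹≗id ⟨
      (mor f ⨾ mor f⁻¹) ⨾ mor g  ≈⟨ ⨾-assoc (mor f) (mor f⁻¹) (mor g) ⟩
      mor f ⨾ (mor f⁻¹ ⨾ mor g)  ∎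
  cover-pullback {C} (ax-cover x σ prem⊆ U U-covers) {D} g =
    D.unionFam S T D a (σ ⨾ mor g) V , ax-cover x (σ ⨾ mor g) prem⊆′ V V-covers , factors
    where
    a = axiom x
    open CoherentAxiom a using (d; k)

    prem⊆′ : ∀ {p} → p ∈ CoherentAxiom.prem a → substAtom (σ ⨾ mor g) p ∈ atoms D
    prem⊆′ {p} p∈ = subst (_∈ _) (D.substAtom-⨾ S σ (mor g) p) (pres g (prem⊆ p∈))

    pulled : (i : Fin d) → Covered (extCond D a (σ ⨾ mor g) i) (FactorsThrough (U i) (extend-hom a σ g i))
    pulled i = cover-pullback (U-covers i) (extend-hom a σ g i)

    V : (i : Fin d) → Family (extCond D a (σ ⨾ mor g) i)
    V i = proj₁ (pulled i)

    V-covers : (i : Fin d) → extCond D a (σ ⨾ mor g) i ◁ V i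
    V-covers i = proj₁ (proj₂ (pulled i))

    factors : (ij : Idx (D.unionFam S T D a (σ ⨾ mor g) V)) →
              FactorsThrough (D.unionFam S T C a σ U) g _ (arr (D.unionFam S T D a (σ ⨾ mor g) V) ij)
    factors (i , j) with proj₂ (proj₂ (pulled i)) j
    ... | lift (j′ , h′ , square) = lift ((i , j′) , h′ , commutes)
      where
      open ≗-Reasoning
      v = mor (arr (V i) j)
      u = mor (arr (U i) j′)
      commutes : (mor g ⨾ (incl (k i) ⨾ v)) ≗ ((incl (k i) ⨾ u) ⨾ mor h′)
      commutes = begin
        mor g ⨾ (incl (k i) ⨾ v)                ≈⟨ ⨾-assoc (mor g) (incl (k i)) v ⟨
        (mor g ⨾ incl (k i)) ⨾ v                ≈⟨ ⨾-congˡ v (incl-⨾-extSub (k i) (mor g)) ⟨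
        (incl (k i) ⨾ extSub (k i) (mor g)) ⨾ v ≈⟨ ⨾-assoc (incl (k i)) (extSub (k i) (mor g)) v ⟩
        incl (k i) ⨾ (extSub (k i) (mor g) ⨾ v) ≈⟨ ⨾-congʳ (incl (k i)) square ⟩
        incl (k i) ⨾ (u ⨾ mor h′)               ≈⟨ ⨾-assoc (incl (k i)) u (mor h′) ⟨
        (incl (k i) ⨾ u) ⨾ mor h′               ∎

  Pred : ℕ → Set₂
  Pred m = (D : Cond) → Sub m (vars D) → Set₁

  Respects : ∀ {m} → Pred m → Set₁
  Respects B = ∀ {D} {ρ ρ′ : Sub _ (vars D)} → ρ ≗ ρ′ → B D ρ → B D ρ′

  Monotone : ∀ {m} → Pred m → Set₁
  Monotone B = ∀ {D E} {ρ : Sub _ (vars D)} → B D ρ → (h : Hom E D) → B E (ρ ⨾ mor h)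

  record Stable {m} (B : Pred m) : Set₁ where
    field
      resp : Respects B
      mono : Monotone B
  open Stable

  precompose-stable : ∀ {m n} {B : Pred m} → Stable B → (σ : Sub m n) → Stable (λ E τ → B E (σ ⨾ τ))
  precompose-stable B-stable σ = record
    { resp = λ e → resp B-stable (⨾-congʳ σ e)
    ; mono = λ {ρ = τ} b h → resp B-stable (⨾-assoc σ τ (mor h)) (mono B-stable b h)
    }

  cover-transitive : ∀ {C} {Q : Pred (vars C)} → Stable Q → ∀ {U} → C ◁ U →
                     ((j : Idx U) → Covered (dom U j) (λ E h → Q E (mor (arr U j) ⨾ mor h))) →
                     Covered C (λ E h → Q E (mor h))
  cover-transitive {C} {Q} Q-stable (iso-cover f (f⁻¹ , f⨾f⁻¹≗id , _)) local
    with local tt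
  ... | W , W-covers , on-W with cover-pullback W-covers f⁻¹
  ...   | V , V-covers , factors = V , V-covers , λ j → restrict (arr V j) (factors j)
    where
    restrict : ∀ {E} (h : Hom E C) → FactorsThrough W f⁻¹ E h → Q E (mor h)
    restrict h (lift (j , h′ , square)) = resp Q-stable chain (mono Q-stable (on-W j) h′)
      where
      open ≗-Reasoning
      w = mor (arr W j)
      chain : ((mor f ⨾ w) ⨾ mor h′) ≗ mor h
      chain = begin
        (mor f ⨾ w) ⨾ mor h′         ≈⟨ ⨾-assoc (mor f) w (mor h′) ⟩
        mor f ⨾ (w ⨾ mor h′)         ≈⟨ ⨾-congʳ (mor f) square ⟨
        mor f ⨾ (mor f⁻¹ ⨾ mor h)    ≈⟨ ⨾-assoc (mor f) (mor f⁻¹) (mor h) ⟨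
        (mor f ⨾ mor f⁻¹) ⨾ mor h    ≈⟨ ⨾-congˡ (mor h) f⨾f⁻¹≗id ⟩
        mor h                        ∎
  cover-transitive {C} {Q} Q-stable (ax-cover x σ prem⊆ U U-covers) local =
    D.unionFam S T C a σ V , ax-cover x σ prem⊆ V (λ i → proj₁ (proj₂ (on-branch i))) ,
    λ { (i , j) → proj₂ (proj₂ (on-branch i)) j }
    where
    a = axiom x
    open CoherentAxiom a using (d; k)

    -- on the i-th branch, Q is read through the inclusion eᵢ
    on-branch : (i : Fin d) → Covered (extCond C a σ i) (λ E h → Q E (incl (k i) ⨾ mor h))
    on-branch i = cover-transitive (precompose-stable Q-stable (incl (k i))) (U-covers i) λ j →
      let (W , W-covers , on-W) = local (i , j) in
      W , W-covers , λ l → resp Q-stable (⨾-assoc (incl (k i)) (mor (arr (U i) j)) (mor (arr W l))) (on-W l)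

    V : (i : Fin d) → Family (extCond C a σ i)
    V i = proj₁ (on-branch i)

  -- B holds locally at (C, σ): after restriction to the members of a cover.
  -- (A record, so that B can be inferred from the type.)
  record Locally {m} (B : Pred m) (C : Cond) (σ : Sub m (vars C)) : Set₁ where
    constructor locally
    field on-cover : Covered C (λ D f → B D (σ ⨾ mor f))
  open Locally

  locally-intro : ∀ {m} {B : Pred m} → Stable B → ∀ {C} {σ : Sub m (vars C)} → B C σ → Locally B C σ
  locally-intro {B = B} B-stable {σ = σ} b =
    locally (covered-by-identity (λ D f → B D (σ ⨾ mor f)) (resp B-stable (≗-sym (⨾-identityʳ σ)) b))

  locally-map : ∀ {m} {B B′ : Pred m} → (∀ {D ρ} → B D ρ → B′ D ρ) →
                ∀ {C} {σ : Sub m (vars C)} → Locally B C σ → Locally B′ C σ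
  locally-map B⇒B′ (locally (U , U-covers , on-U)) = locally (U , U-covers , λ j → B⇒B′ (on-U j))

  locally-mono : ∀ {m} {B : Pred m} → Stable B → Monotone (Locally B)
  locally-mono {B = B} B-stable {ρ = σ} (locally (U , U-covers , on-U)) g with cover-pullback U-covers g
  ... | V , V-covers , factors = locally (V , V-covers , λ l → restrict (arr V l) (factors l))
    where
    restrict : ∀ {E} (h : Hom E _) → FactorsThrough U g E h → B E ((σ ⨾ mor g) ⨾ mor h)
    restrict h (lift (j , h′ , square)) = resp B-stable chain (mono B-stable (on-U j) h′)
      where
      open ≗-Reasoning
      u = mor (arr U j)
      chain : ((σ ⨾ u) ⨾ mor h′) ≗ ((σ ⨾ mor g) ⨾ mor h)
      chain = begin
        (σ ⨾ u) ⨾ mor h′         ≈⟨ ⨾-assoc σ u (mor h′) ⟩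
        σ ⨾ (u ⨾ mor h′)         ≈⟨ ⨾-congʳ σ square ⟨
        σ ⨾ (mor g ⨾ mor h)      ≈⟨ ⨾-assoc σ (mor g) (mor h) ⟨
        (σ ⨾ mor g) ⨾ mor h      ∎

  locally-join : ∀ {m} {B : Pred m} → Stable B → ∀ {C} {σ : Sub m (vars C)} →
                 Locally (Locally B) C σ → Locally B C σ
  locally-join B-stable {σ = σ} (locally (U , U-covers , on-U)) =
    locally (cover-transitive (precompose-stable B-stable σ) U-covers λ j →
      let (W , W-covers , on-W) = on-cover (on-U j) in
      W , W-covers , λ l → resp B-stable (⨾-assoc σ (mor (arr U j)) (mor (arr W l))) (on-W l))

  ×-stable : ∀ {m} {B B′ : Pred m} → Stable B → Stable B′ → Stable (λ D ρ → B D ρ × B′ D ρ)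
  ×-stable B-stable B′-stable = record
    { resp = λ e (b , b′) → resp B-stable e b , resp B′-stable e b′
    ; mono = λ (b , b′) h → mono B-stable b h , mono B′-stable b′ h
    }

  locally-pair : ∀ {m} {B B′ : Pred m} → Stable B → Stable B′ → ∀ {C} {σ : Sub m (vars C)} →
                 Locally B C σ → Locally B′ C σ → Locally (λ D ρ → B D ρ × B′ D ρ) C σ
  locally-pair {B = B} {B′} B-stable B′-stable (locally (U , U-covers , on-U)) on-V =
    locally-join (×-stable B-stable B′-stable)
      (locally (U , U-covers , λ j → pair-with (on-U j) (locally-mono B′-stable on-V (arr U j))))
    where
    pair-with : ∀ {D ρ} → B D ρ → Locally B′ D ρ → Locally (λ E τ → B E τ × B′ E τ) D ρ
    pair-with b (locally (W , W-covers , on-W)) =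
      locally (W , W-covers , λ l → mono B-stable b (arr W l) , on-W l)

  -- the properties out of which forcing of atoms, equations, ⊥, ⋁ and ∃ is
  -- built by "Locally"
  AtomIn : ∀ {m} → Atom m → Pred m
  AtomIn ψ D ρ = Lift₁ (substAtom ρ ψ ∈ atoms D)

  Equal : ∀ {m} → Tm m → Tm m → Pred m
  Equal s t D ρ = Lift₁ (substTm ρ s ≡ substTm ρ t)

  Never : ∀ {m} → Pred m
  Never D ρ = Lift₁ ⊥

  SomeOf : ∀ {m} {I : Set} → (I → Pred m) → Pred m
  SomeOf {I = I} B D ρ = Σ I λ i → B i D ρ

  Witnessed : ∀ {m} → Pred (suc m) → Pred m
  Witnessed B D ρ = Σ (Tm (vars D)) λ t → B D (ρ ▸ t)

  atomIn-stable : ∀ {m} (ψ : Atom m) → Stable (AtomIn ψ)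
  atomIn-stable ψ = record
    { resp = λ e (lift ψ∈) → lift (subst (_∈ _) (substAtom-cong e ψ) ψ∈)
    ; mono = λ {ρ = ρ} (lift ψ∈) h → lift (subst (_∈ _) (D.substAtom-⨾ S ρ (mor h) ψ) (pres h ψ∈))
    }

  equal-stable : ∀ {m} (s t : Tm m) → Stable (Equal s t)
  equal-stable s t = record
    { resp = λ e (lift s≡t) → lift (trans (sym (substTm-cong e s)) (trans s≡t (substTm-cong e t)))
    ; mono = λ {ρ = ρ} (lift s≡t) h →
        lift (trans (sym (D.substTm-⨾ S ρ (mor h) s))
                    (trans (cong (substTm (mor h)) s≡t) (D.substTm-⨾ S ρ (mor h) t)))
    }

  never-stable : ∀ {m} → Stable (Never {m})
  never-stable = record { resp = λ _ b → b ; mono = λ b _ → b }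

  someOf-stable : ∀ {m} {I : Set} {B : I → Pred m} → ((i : I) → Stable (B i)) → Stable (SomeOf B)
  someOf-stable B-stable = record
    { resp = λ e (i , b) → i , resp (B-stable i) e b
    ; mono = λ (i , b) h → i , mono (B-stable i) b h
    }

  -- a witness t is transported along h as the term t h
  witnessed-stable : ∀ {m} {B : Pred (suc m)} → Stable B → Stable (Witnessed B)
  witnessed-stable B-stable = record
    { resp = λ e (t , b) → t , resp B-stable (▸-cong e refl) b
    ; mono = λ (t , b) h → substTm (mor h) t , resp B-stable ▸-⨾ (mono B-stable b h)
    }

  ⊥-locally : ∀ {m C} {σ : Sub m (vars C)} → Force ⊥' C σ → Locally Never C σ
  ⊥-locally (U , U-covers , empty) = locally (U , U-covers , λ j → ⊥-elim (empty j))

  locally-⊥ : ∀ {m C} {σ : Sub m (vars C)} → Locally Never C σ → Force ⊥' C σ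
  locally-⊥ (locally (U , U-covers , never)) = U , U-covers , λ j → lower (never j)

  -- forcing depends on the substitution only up to pointwise equality;
  -- for the "local" connectives the same cover serves
  force-resp : ∀ {m} (φ : Fm m) → Respects (Force φ)
  force-resp ⊤'        e p = p
  force-resp ⊥'        e p = p
  force-resp (atom ψ)  e (U , U-covers , on-U) =
    U , U-covers , λ j → resp (atomIn-stable ψ) (⨾-congˡ (mor (arr U j)) e) (on-U j)
  force-resp (s ≐ t)   e (U , U-covers , on-U) =
    U , U-covers , λ j → resp (equal-stable s t) {dom U j} (⨾-congˡ (mor (arr U j)) e) (on-U j)
  force-resp (⋀ I ψ)   e p = λ i → force-resp (ψ i) e (p i)
  force-resp (⋁ I ψ)   e (U , U-covers , on-U) = U , U-covers , λ j →
    let (i , q) = on-U j in i , force-resp (ψ i) (⨾-congˡ (mor (arr U j)) e) q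
  force-resp (ψ₁ ⇒ ψ₂) e p = λ D f q →
    force-resp ψ₂ (⨾-congˡ (mor f) e) (p D f (force-resp ψ₁ (⨾-congˡ (mor f) (≗-sym e)) q))
  force-resp (∀' ψ)    e p = λ D f t → force-resp ψ (▸-cong (⨾-congˡ (mor f) e) refl) (p D f t)
  force-resp (∃' ψ)    e (U , U-covers , on-U) = U , U-covers , λ j →
    let (t , q) = on-U j in t , force-resp ψ (▸-cong (⨾-congˡ (mor (arr U j)) e) refl) q

  mutual
    force-stable : ∀ {m} (φ : Fm m) → Stable (Force φ)
    force-stable φ = record { resp = force-resp φ ; mono = force-mono φ }

    force-mono : ∀ {m} (φ : Fm m) → Monotone (Force φ)
    force-mono ⊤'        p g = p
    force-mono ⊥'        {ρ = σ} p g = locally-⊥ (locally-mono never-stable (⊥-locally {σ = σ} p) g)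
    force-mono (atom ψ)  {ρ = σ} p g = on-cover (locally-mono (atomIn-stable ψ) (locally {σ = σ} p) g)
    force-mono (s ≐ t)   {ρ = σ} p g = on-cover (locally-mono (equal-stable s t) (locally {σ = σ} p) g)
    force-mono (⋀ I ψ)   p g = λ i → force-mono (ψ i) (p i) g
    force-mono (⋁ I ψ)   {ρ = σ} p g =
      on-cover (locally-mono (someOf-stable (λ i → force-stable (ψ i))) (locally {σ = σ} p) g)
    force-mono (ψ₁ ⇒ ψ₂) {ρ = σ} p g = λ E h q →
      force-resp ψ₂ (≗-sym (⨾-assoc σ (mor g) (mor h)))
        (p E (g ∘ₕ h) (force-resp ψ₁ (⨾-assoc σ (mor g) (mor h)) q))
    force-mono (∀' ψ)    {ρ = σ} p g = λ E h t →
      force-resp ψ (▸-cong (≗-sym (⨾-assoc σ (mor g) (mor h))) refl) (p E (g ∘ₕ h) t)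
    force-mono (∃' ψ)    {ρ = σ} p g =
      on-cover (locally-mono (witnessed-stable (force-stable ψ)) (locally {σ = σ} p) g)

  force-apply : ∀ {m} (ψ₁ ψ₂ : Fm m) {C} {σ : Sub m (vars C)} →
                Force (ψ₁ ⇒ ψ₂) C σ → Force ψ₁ C σ → Force ψ₂ C σ
  force-apply ψ₁ ψ₂ {σ = σ} p q =
    force-resp ψ₂ (⨾-identityʳ σ) (p _ idHom (force-resp ψ₁ (≗-sym (⨾-identityʳ σ)) q))

  force-instance : ∀ {m} (ψ : Fm (suc m)) {C} {σ : Sub m (vars C)} →
                   Force (∀' ψ) C σ → (t : Tm (vars C)) → Force ψ C (σ ▸ t)
  force-instance ψ {σ = σ} p t = force-resp ψ (▸-cong (⨾-identityʳ σ) refl) (p _ idHom t)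

  force-local : ∀ {m} (φ : Fm m) {C} {σ : Sub m (vars C)} → Locally (Force φ) C σ → Force φ C σ
  force-local ⊤'       _ = lift tt
  force-local ⊥'       p = locally-⊥ (locally-join never-stable (locally-map ⊥-locally p))
  force-local (atom ψ) p = on-cover (locally-join (atomIn-stable ψ) (locally-map locally p))
  force-local (s ≐ t)  p = on-cover (locally-join (equal-stable s t) (locally-map locally p))
  force-local (⋀ I ψ)  p = λ i → force-local (ψ i) (locally-map (λ q → q i) p)
  force-local (⋁ I ψ)  p =
    on-cover (locally-join (someOf-stable (λ i → force-stable (ψ i))) (locally-map locally p))
  force-local (∃' ψ)   p = on-cover (locally-join (witnessed-stable (force-stable ψ)) (locally-map locally p))
  force-local (ψ₁ ⇒ ψ₂) p D g q with locally-mono (force-stable (ψ₁ ⇒ ψ₂)) p g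
  ... | locally (U , U-covers , on-U) =
    force-local ψ₂ (locally (U , U-covers , λ j → force-apply ψ₁ ψ₂ (on-U j) (force-mono ψ₁ q (arr U j))))
  force-local (∀' ψ)   p D g t with locally-mono (force-stable (∀' ψ)) p g
  ... | locally (U , U-covers , on-U) =
    force-local ψ (locally (U , U-covers , λ j →
      force-resp ψ (≗-sym ▸-⨾) (force-instance ψ (on-U j) (substTm (mor (arr U j)) t))))

  -- Substitution lemma: φτ is forced under σ iff φ is forced under τ ⨾ σ
  -- (stated for any ρ ≗ τ ⨾ σ, which absorbs all associativity bookkeeping).
  mutual
    force-subst→ : ∀ {m n} (φ : Fm m) (τ : Sub m n) {C} {σ : Sub n (vars C)} {ρ : Sub m (vars C)} →
                   (τ ⨾ σ) ≗ ρ → Force (substFm τ φ) C σ → Force φ C ρ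
    force-subst→ ⊤'        τ e p = p
    force-subst→ ⊥'        τ e p = p
    force-subst→ (atom a)  τ e (U , U-covers , on-U) = U , U-covers , λ j →
      lift (subst (_∈ _) (substAtom-comp τ (⨾-restrict τ (mor (arr U j)) e) a) (lower (on-U j)))
    force-subst→ (s ≐ t)   τ e (U , U-covers , on-U) = U , U-covers , λ j →
      let r = ⨾-restrict τ (mor (arr U j)) e in
      lift (trans (sym (substTm-comp τ r s)) (trans (lower (on-U j)) (substTm-comp τ r t)))
    force-subst→ (⋀ I ψ)   τ e p = λ i → force-subst→ (ψ i) τ e (p i)
    force-subst→ (⋁ I ψ)   τ e (U , U-covers , on-U) = U , U-covers , λ j →
      let (i , q) = on-U j in i , force-subst→ (ψ i) τ (⨾-restrict τ (mor (arr U j)) e) q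
    force-subst→ (ψ₁ ⇒ ψ₂) τ e p = λ D f q →
      force-subst→ ψ₂ τ (⨾-restrict τ (mor f) e) (p D f (force-subst← ψ₁ τ (⨾-restrict τ (mor f) e) q))
    force-subst→ (∀' ψ)    τ e p = λ D f t →
      force-subst→ ψ (D.lift S τ) (lift-⨾-▸ τ (⨾-restrict τ (mor f) e)) (p D f t)
    force-subst→ (∃' ψ)    τ e (U , U-covers , on-U) = U , U-covers , λ j →
      let (t , q) = on-U j in
      t , force-subst→ ψ (D.lift S τ) (lift-⨾-▸ τ (⨾-restrict τ (mor (arr U j)) e)) q

    force-subst← : ∀ {m n} (φ : Fm m) (τ : Sub m n) {C} {σ : Sub n (vars C)} {ρ : Sub m (vars C)} →
                   (τ ⨾ σ) ≗ ρ → Force φ C ρ → Force (substFm τ φ) C σ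
    force-subst← ⊤'        τ e p = p
    force-subst← ⊥'        τ e p = p
    force-subst← (atom a)  τ e (U , U-covers , on-U) = U , U-covers , λ j →
      lift (subst (_∈ _) (sym (substAtom-comp τ (⨾-restrict τ (mor (arr U j)) e) a)) (lower (on-U j)))
    force-subst← (s ≐ t)   τ e (U , U-covers , on-U) = U , U-covers , λ j →
      let r = ⨾-restrict τ (mor (arr U j)) e in
      lift (trans (substTm-comp τ r s) (trans (lower (on-U j)) (sym (substTm-comp τ r t))))
    force-subst← (⋀ I ψ)   τ e p = λ i → force-subst← (ψ i) τ e (p i)
    force-subst← (⋁ I ψ)   τ e (U , U-covers , on-U) = U , U-covers , λ j →
      let (i , q) = on-U j in i , force-subst← (ψ i) τ (⨾-restrict τ (mor (arr U j)) e) q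
    force-subst← (ψ₁ ⇒ ψ₂) τ e p = λ D f q →
      force-subst← ψ₂ τ (⨾-restrict τ (mor f) e) (p D f (force-subst→ ψ₁ τ (⨾-restrict τ (mor f) e) q))
    force-subst← (∀' ψ)    τ e p = λ D f t →
      force-subst← ψ (D.lift S τ) (lift-⨾-▸ τ (⨾-restrict τ (mor f) e)) (p D f t)
    force-subst← (∃' ψ)    τ e (U , U-covers , on-U) = U , U-covers , λ j →
      let (t , q) = on-U j in
      t , force-subst← ψ (D.lift S τ) (lift-⨾-▸ τ (⨾-restrict τ (mor (arr U j)) e)) q

  force-allN : ∀ m (φ : Fm m) → (∀ D (ρ : Sub m (vars D)) → Force φ D ρ) →
               ∀ {C} (σ : Sub 0 (vars C)) → Force (D.allN S m φ) C σ
  force-allN zero    φ forced σ = forced _ σ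
  force-allN (suc m) φ forced σ = force-allN m (∀' φ) (λ D ρ E f t → forced E _) σ

  force-witness : ∀ {m} (ψ : Fm (suc m)) {C} {σ : Sub m (vars C)} (t : Tm (vars C)) →
                  Force ψ C (σ ▸ t) → Force (∃' ψ) C σ
  force-witness ψ {σ = σ} t p = on-cover (locally-intro (witnessed-stable (force-stable ψ)) {σ = σ} (t , p))

  -- k existential quantifiers are witnessed by the first k values of ρ
  force-exN : ∀ k {m} (φ : Fm (k + m)) {C} {σ : Sub m (vars C)} (ρ : Sub (k + m) (vars C)) →
              (∀ x → ρ (k ↑ʳ x) ≡ σ x) → Force φ C ρ → Force (D.exN S k φ) C σ
  force-exN zero    φ ρ agree p = force-resp φ agree p
  force-exN (suc k) φ ρ agree p =
    force-exN k (∃' φ) (λ x → ρ (suc x)) agree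
      (force-witness φ (ρ zero) (force-resp φ (λ { zero → refl ; (suc _) → refl }) p))

  force-conj : ∀ {m} (A : List (Atom m)) {C} {σ : Sub m (vars C)} →
               (∀ {p} → p ∈ A → substAtom σ p ∈ atoms C) → Force (D.conj S A) C σ
  force-conj A {σ = σ} A-holds i =
    on-cover (locally-intro (atomIn-stable _) {σ = σ} (lift (A-holds (∈-lookup i))))

  conj-forces-atoms : ∀ {m} (A : List (Atom m)) {C} {σ : Sub m (vars C)} →
                      Force (D.conj S A) C σ → ∀ {p} → p ∈ A → Force (atom p) C σ
  conj-forces-atoms A {C} {σ} forced p∈ =
    subst (λ q → Force (atom q) C σ) (sym (lookup-index p∈)) (forced (index p∈))

  AllIn : ∀ {m} → List (Atom m) → Pred m
  AllIn A D ρ = Lift₁ (∀ {p} → p ∈ A → substAtom ρ p ∈ atoms D)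

  allIn-stable : ∀ {m} (A : List (Atom m)) → Stable (AllIn A)
  allIn-stable A = record
    { resp = λ e (lift holds) → lift (λ p∈ → subst (_∈ _) (substAtom-cong e _) (holds p∈))
    ; mono = λ {ρ = ρ} (lift holds) h →
        lift (λ {p} p∈ → subst (_∈ _) (D.substAtom-⨾ S ρ (mor h) p) (pres h (holds p∈)))
    }

  atoms-hold-locally : ∀ {m} (A : List (Atom m)) {C} {σ : Sub m (vars C)} →
                       (∀ {p} → p ∈ A → Force (atom p) C σ) → Locally (AllIn A) C σ
  atoms-hold-locally []      {σ = σ} forced = locally-intro (allIn-stable []) {σ = σ} (lift λ ())
  atoms-hold-locally (p ∷ A) {σ = σ} forced =
    locally-map (λ (lift p-holds , lift A-holds) →
                   lift λ { (here refl) → p-holds ; (there q) → A-holds q })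
      (locally-pair (atomIn-stable p) (allIn-stable A) (locally {σ = σ} (forced (here refl)))
        (atoms-hold-locally A (λ q → forced (there q))))

  module _ (x : Ax) where
    open CoherentAxiom (axiom x)

    Conclusion : Fm m
    Conclusion = ⋁ (Fin d) (λ i → D.exN S (k i) (D.conj S (concl i)))

    -- an instance of the axiom whose premises hold at G has its conclusion
    -- forced at G, on the cover by the axiom itself
    conclusion-forced : ∀ {G} (σ : Sub m (vars G)) → (∀ {p} → p ∈ prem → substAtom σ p ∈ atoms G) →
                        Force Conclusion G σ
    conclusion-forced {G} σ prem-holds =
      D.unionFam S T G (axiom x) σ (λ _ → D.singleton S idHom) ,
      ax-cover x σ prem-holds _ (λ _ → iso-cover idHom idHom-iso) ,
      λ { (i , tt) → i , force-exN (k i) (D.conj S (concl i)) (extSub (k i) σ)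
                           (λ y → trans (incl-⨾-extSub (k i) σ y) (substTm-cong (λ _ → refl) (σ y)))
                           (force-conj (concl i) (λ p∈ → ∈-++⁺ʳ _ (∈-map⁺ _ p∈))) }

    axiom-body-forced : ∀ D (ρ : Sub m (vars D)) → Force (D.conj S prem ⇒ Conclusion) D ρ
    axiom-body-forced D ρ E g premises =
      force-local Conclusion {σ = ρ ⨾ mor g}
        (locally-map (λ (lift holds) → conclusion-forced _ holds)
          (atoms-hold-locally prem (conj-forces-atoms prem {σ = ρ ⨾ mor g} premises)))

  force-axiom : ∀ {n} (x : Ax) {C : Cond} (σ : Sub n (vars C)) →
                Force (substFm (λ ()) (D.axiomSentence S (axiom x))) C σ
  force-axiom x σ =
    force-subst← (D.axiomSentence S (axiom x)) (λ ()) (λ ())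
      (force-allN (CoherentAxiom.m (axiom x)) _ (axiom-body-forced x) (λ ()))

  force-⊥-elim : ∀ {m} (φ : Fm m) {C} {σ : Sub m (vars C)} → Force ⊥' C σ → Force φ C σ
  force-⊥-elim φ {σ = σ} p = force-local φ (locally-map (λ { (lift ()) }) (⊥-locally {σ = σ} p))

  force-⋁-intro : ∀ {m} {I : Set} (ψ : I → Fm m) {C} {σ : Sub m (vars C)} (i : I) →
                  Force (ψ i) C σ → Force (⋁ I ψ) C σ
  force-⋁-intro ψ {σ = σ} i p =
    on-cover (locally-intro (someOf-stable (λ j → force-stable (ψ j))) {σ = σ} (i , p))

  force-⋁-elim : ∀ {m} {I : Set} (ψ : I → Fm m) (φ : Fm m) {C} {σ : Sub m (vars C)} →
                 Force (⋁ I ψ) C σ →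
                 (∀ {D} (f : Hom D C) (i : I) → Force (ψ i) D (σ ⨾ mor f) → Force φ D (σ ⨾ mor f)) →
                 Force φ C σ
  force-⋁-elim ψ φ {σ = σ} (U , U-covers , on-U) branch =
    force-local φ {σ = σ} (locally (U , U-covers , λ j → branch (arr U j) (proj₁ (on-U j)) (proj₂ (on-U j))))

  force-∀-elim : ∀ {n} (φ : Fm (suc n)) {C} {σ : Sub n (vars C)} → Force (∀' φ) C σ →
                 (t : Tm n) → Force (D.inst S φ t) C σ
  force-∀-elim φ {σ = σ} p t = force-subst← φ (var ▸ t) ▸-⨾ (force-instance φ p (substTm σ t))

  force-∃-intro : ∀ {n} (φ : Fm (suc n)) {C} {σ : Sub n (vars C)} (t : Tm n) →
                  Force (D.inst S φ t) C σ → Force (∃' φ) C σ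
  force-∃-intro φ {σ = σ} t p = force-witness φ (substTm σ t) (force-subst→ φ (var ▸ t) ▸-⨾ p)

  force-∃-elim : ∀ {m} (ψ : Fm (suc m)) (φ : Fm m) {C} {σ : Sub m (vars C)} → Force (∃' ψ) C σ →
                 (∀ {D} (f : Hom D C) (t : Tm (vars D)) → Force ψ D ((σ ⨾ mor f) ▸ t) → Force φ D (σ ⨾ mor f)) →
                 Force φ C σ
  force-∃-elim ψ φ {σ = σ} (U , U-covers , on-U) branch =
    force-local φ {σ = σ} (locally (U , U-covers , λ j → branch (arr U j) (proj₁ (on-U j)) (proj₂ (on-U j))))

  force-≐-refl : ∀ {n} (t : Tm n) {C} {σ : Sub n (vars C)} → Force (t ≐ t) C σ
  force-≐-refl t {σ = σ} = on-cover (locally-intro (equal-stable t t) {σ = σ} (lift refl))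

  -- Leibniz's law: on a cover s and t become equal, so φ[s] turns into φ[t]
  force-≐-elim : ∀ {n} (s t : Tm n) (φ : Fm (suc n)) {C} {σ : Sub n (vars C)} →
                 Force (s ≐ t) C σ → Force (D.inst S φ s) C σ → Force (D.inst S φ t) C σ
  force-≐-elim s t φ {C} {σ} (U , U-covers , on-U) p =
    force-local (D.inst S φ t) {σ = σ} (locally (U , U-covers , λ j → transfer (arr U j) (lower (on-U j))))
    where
    transfer : ∀ {E} (f : Hom E C) → substTm (σ ⨾ mor f) s ≡ substTm (σ ⨾ mor f) t →
               Force (D.inst S φ t) E (σ ⨾ mor f)
    transfer f s≡t =
      force-subst← φ (var ▸ t) ▸-⨾
        (force-resp φ (▸-cong (λ _ → refl) s≡t)
          (force-subst→ φ (var ▸ s) ▸-⨾ (force-mono (D.inst S φ s) p f)))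

  Env : ∀ {n} → List (Fm n) → (C : Cond) → Sub n (vars C) → Set₁
  Env Γ C σ = ∀ {ψ} → ψ ∈ Γ → Force ψ C σ

  env-cons : ∀ {n} {φ : Fm n} {Γ C σ} → Force φ C σ → Env Γ C σ → Env (φ ∷ Γ) C σ
  env-cons p env (here refl) = p
  env-cons p env (there q)   = env q

  env-mono : ∀ {n} {Γ : List (Fm n)} {C σ} → Env Γ C σ → ∀ {D} (f : Hom D C) → Env Γ D (σ ⨾ mor f)
  env-mono env f {ψ} q = force-mono ψ (env q) f

  env-weaken : ∀ {n} {Γ : List (Fm n)} {D} {ρ : Sub n (vars D)} (t : Tm (vars D)) →
               Env Γ D ρ → Env (map (D.wkFm S) Γ) D (ρ ▸ t)
  env-weaken t env q with ∈-map⁻ (D.wkFm S) q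
  ... | ψ , q′ , refl = force-subst← ψ (D.wkSub S) (λ _ → refl) (env q′)

  sound : ∀ {n Γ φ} → D.Der S T n Γ φ → ∀ {C} (σ : Sub n (vars C)) → Env Γ C σ → Force φ C σ
  sound (hyp q)                   σ env = env q
  sound (axT x)                   σ env = force-axiom x σ
  sound ⊤I                        σ env = lift tt
  sound {φ = φ} (⊥E d)            σ env = force-⊥-elim φ (sound d σ env)
  sound (⋀I ds)                   σ env = λ i → sound (ds i) σ env
  sound (⋀E d i)                  σ env = sound d σ env i
  sound (⋁I {φ = ψ} i d)          σ env = force-⋁-intro ψ i (sound d σ env)
  sound {φ = φ} (⋁E {φ = ψ} d ds) σ env =
    force-⋁-elim ψ φ (sound d σ env) λ f i q → sound (ds i) (σ ⨾ mor f) (env-cons q (env-mono env f))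
  sound (⇒I d)                    σ env = λ D f q → sound d (σ ⨾ mor f) (env-cons q (env-mono env f))
  sound (⇒E {φ = ψ₁} {ψ₂} d e)    σ env = force-apply ψ₁ ψ₂ (sound d σ env) (sound e σ env)
  sound (∀I d)                    σ env = λ D f t → sound d ((σ ⨾ mor f) ▸ t) (env-weaken t (env-mono env f))
  sound (∀E {φ = ψ} d t)          σ env = force-∀-elim ψ (sound d σ env) t
  sound (∃I {φ = ψ} t d)          σ env = force-∃-intro ψ t (sound d σ env)
  sound {φ = φ} (∃E {φ = ψ} d e)  σ env =
    force-∃-elim ψ φ (sound d σ env) λ f t q →
      force-subst→ φ (D.wkSub S) (λ _ → refl)
        (sound e ((σ ⨾ mor f) ▸ t) (env-cons q (env-weaken t (env-mono env f))))
  sound (≐refl {t})               σ env = force-≐-refl t {σ = σ}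
  sound (≐E {s} {t} d φ e)        σ env = force-≐-elim s t φ (sound d σ env) (sound e σ env)

corollary5p6 : (S : Signature) (c : Cat) (T : CoherentTheory S) (φ : Sentence S) →
    _⊢∅_ S T φ → _⊩_ S {c} T (emptyCond S) φ
corollary5p6 S c T φ derivation = Soundness.sound S c T derivation var (λ ())
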